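{- Let $\mathsf{J}\mathbb{N}=(\mathbb{N}^\mathbb{N}\to\mathbb{N})\times(\mathbb{N}^\mathbb{N}\to\mathbb{N})$, writing $\mathrm{V}_w$ and $\mathrm{M}_w$ for the first and second components of $w:\mathsf{J}\mathbb{N}$. Define \[ \eta(n):=\langle\lambda\alpha.n,\ \lambda\alpha.0\rangle,\qquad \kappa(g,w):=\big\langle\lambda\alpha.\mathrm{V}_{g(\mathrm{V}_w(\alpha))}(\alpha),\ \lambda\alpha.\max(\mathrm{M}_{g(\mathrm{V}_w(\alpha))}(\alpha),\mathrm{M}_w(\alpha))\big\rangle, \] and $\Omega:\mathsf{J}\mathbb{N}\to\mathsf{J}\mathbb{N}$ by $\Omega:=\kappa(\lambda n.\langle\lambda\alpha.\alpha n,\ \lambda\alpha.n+1\rangle)$. Then for every closed term $f:\mathbb{N}^\mathbb{N}\to\mathbb{N}$ of $\mathsf{T}$ (extended with products), the function $M:=\mathrm{M}_{f^\mathsf{J}(\Omega)}:\mathbb{N}^\mathbb{N}\to\mathbb{N}$ is a modulus of continuity of $f$, i.e. \[ \forall\alpha^{\mathbb{N}^\mathbb{N}}\beta^{\mathbb{N}^\mathbb{N}}\big(\alpha=_{M\alpha}\beta\to f\alpha=f\beta\big), \] where $\alpha=_m\beta$ means $\forall i<m\,(\alpha i=\beta i)$.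
   Context: System $\mathsf{T}$ extended with products: types $\mathbb{N}$, $\sigma\to\tau$, $\sigma\times\tau$; terms: variables, $\lambda$-abstraction, application, $0$, $\mathsf{suc}$, $\mathsf{rec}_\sigma:\sigma\to(\mathbb{N}\to\sigma\to\sigma)\to\mathbb{N}\to\sigma$ (with $\mathsf{rec}(a,f,0)=a$, $\mathsf{rec}(a,f,n+1)=f(n,\mathsf{rec}(a,f,n))$), and $\mathsf{pair}:\sigma\to\tau\to\sigma\times\tau$ (written $\langle a,b\rangle$), $\mathsf{pr}_1,\mathsf{pr}_2$ with the usual computation rules. $\mathbb{N}^\mathbb{N}$ denotes $\mathbb{N}\to\mathbb{N}$; $\max$ is definable in $\mathsf{T}$. Terms are interpreted as functionals of finite type. The $\mathsf{J}$-translation for a nucleus $(\mathsf{J}\mathbb{N},\eta,\kappa)$ (a type $\mathsf{J}\mathbb{N}$ and terms $\eta:\mathbb{N}\to\mathsf{J}\mathbb{N}$, $\kappa:(\mathbb{N}\to\mathsf{J}\mathbb{N})\to\mathsf{J}\mathbb{N}\to\mathsf{J}\mathbb{N}$): on types $\mathbb{N}^\mathsf{J}:=\mathsf{J}\mathbb{N}$, $(\sigma\to\tau)^\mathsf{J}:=\sigma^\mathsf{J}\to\tau^\mathsf{J}$, $(\sigma\times\tau)^\mathsf{J}:=\sigma^\mathsf{J}\times\tau^\mathsf{J}$; on terms, variables $x:\sigma$ go to fresh $x^\mathsf{J}:\sigma^\mathsf{J}$, $(\lambda x.t)^\mathsf{J}:=\lambda x^\mathsf{J}.t^\mathsf{J}$,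 $(tu)^\mathsf{J}:=t^\mathsf{J}u^\mathsf{J}$, $0^\mathsf{J}:=\eta\,0$, $\mathsf{suc}^\mathsf{J}:=\kappa(\eta\circ\mathsf{suc})$, $\mathsf{pair},\mathsf{pr}_1,\mathsf{pr}_2$ translate to themselves at the translated types, and $(\mathsf{rec}_\sigma)^\mathsf{J}:=\lambda x^{\sigma^\mathsf{J}}f^{\mathsf{J}\mathbb{N}\to\sigma^\mathsf{J}\to\sigma^\mathsf{J}}.\,\mathrm{ke}_\sigma(\mathsf{rec}_{\sigma^\mathsf{J}}(x,f\circ\eta))$, where $\mathrm{ke}_\sigma:(\mathbb{N}\to\sigma^\mathsf{J})\to\mathsf{J}\mathbb{N}\to\sigma^\mathsf{J}$ is given by $\mathrm{ke}_\mathbb{N}:=\kappa$, $\mathrm{ke}_{\sigma\to\tau}:=\lambda g\,a\,x.\,\mathrm{ke}_\tau(\lambda n.g(n,x),a)$, $\mathrm{ke}_{\sigma\times\tau}:=\lambda g\,a.\,\langle\mathrm{ke}_\sigma(\mathsf{pr}_1\circ g,a),\mathrm{ke}_\tau(\mathsf{pr}_2\circ g,a)\rangle$. In particular $f^\mathsf{J}:(\mathsf{J}\mathbb{N}\to\mathsf{J}\mathbb{N})\to\mathsf{J}\mathbb{N}$ for $f:\mathbb{N}^\mathbb{N}\to\mathbb{N}$. -}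

module Defs where

open import Data.Nat using (ℕ; zero; suc; _⊔_)
open import Data.Product using (_×_; _,_; proj₁; proj₂)
open import Data.Unit using (⊤; tt)
open import Data.List using (List; []; _∷_)

infixr 7 _⇒_
infixr 8 _⊗_
data Ty : Set where
  ι   : Ty
  _⇒_ : Ty → Ty → Ty
  _⊗_ : Ty → Ty → Ty

Ctx : Set
Ctx = List Ty

data _∋_ : Ctx → Ty → Set where
  here  : ∀ {Γ σ} → (σ ∷ Γ) ∋ σ
  there : ∀ {Γ σ τ} → Γ ∋ σ → (τ ∷ Γ) ∋ σ

data Tm (Γ : Ctx) : Ty → Set where
  var  : ∀ {σ} → Γ ∋ σ → Tm Γ σ
  lam  : ∀ {σ τ} → Tm (σ ∷ Γ) τ → Tm Γ (σ ⇒ τ)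
  app  : ∀ {σ τ} → Tm Γ (σ ⇒ τ) → Tm Γ σ → Tm Γ τ
  zer  : Tm Γ ι
  succ : Tm Γ (ι ⇒ ι)
  rec  : ∀ σ → Tm Γ (σ ⇒ (ι ⇒ σ ⇒ σ) ⇒ ι ⇒ σ)
  pair : ∀ {σ τ} → Tm Γ (σ ⇒ τ ⇒ σ ⊗ τ)
  pr₁  : ∀ {σ τ} → Tm Γ (σ ⊗ τ ⇒ σ)
  pr₂  : ∀ {σ τ} → Tm Γ (σ ⊗ τ ⇒ τ)

Closed : Ty → Set
Closed = Tm []

⟦_⟧ : Ty → Set
⟦ ι ⟧     = ℕ
⟦ σ ⇒ τ ⟧ = ⟦ σ ⟧ → ⟦ τ ⟧
⟦ σ ⊗ τ ⟧ = ⟦ σ ⟧ × ⟦ τ ⟧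

Env : Ctx → Set
Env []      = ⊤
Env (σ ∷ Γ) = ⟦ σ ⟧ × Env Γ

lookup : ∀ {Γ σ} → Env Γ → Γ ∋ σ → ⟦ σ ⟧
lookup (a , ρ) here      = a
lookup (a , ρ) (there x) = lookup ρ x

recℕ : {A : Set} → A → (ℕ → A → A) → ℕ → A
recℕ a f zero    = a
recℕ a f (suc n) = f n (recℕ a f n)

eval : ∀ {Γ σ} → Tm Γ σ → Env Γ → ⟦ σ ⟧
eval (var x)   ρ = lookup ρ x
eval (lam t)   ρ = λ a → eval t (a , ρ)
eval (app t u) ρ = eval t ρ (eval u ρ)
eval zer       ρ = zero
eval succ      ρ = suc
eval (rec σ)   ρ = recℕ
eval pair      ρ = _,_
eval pr₁       ρ = proj₁
eval pr₂       ρ = proj₂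

-- The J-translation for a nucleus (JN, η, κ), composed with the interpretation:
-- jeval t is the interpretation of the translated term t^J.
module JTranslation (JN : Ty)
                    (η : ℕ → ⟦ JN ⟧)
                    (κ : (ℕ → ⟦ JN ⟧) → ⟦ JN ⟧ → ⟦ JN ⟧) where

  _ᴶ : Ty → Ty
  ι ᴶ       = JN
  (σ ⇒ τ) ᴶ = σ ᴶ ⇒ τ ᴶ
  (σ ⊗ τ) ᴶ = σ ᴶ ⊗ τ ᴶ

  ke : ∀ σ → (ℕ → ⟦ σ ᴶ ⟧) → ⟦ JN ⟧ → ⟦ σ ᴶ ⟧
  ke ι       g a = κ g a
  ke (σ ⇒ τ) g a = λ x → ke τ (λ n → g n x) a
  ke (σ ⊗ τ) g a = ke σ (λ n → proj₁ (g n)) a , ke τ (λ n → proj₂ (g n)) a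

  Envᴶ : Ctx → Set
  Envᴶ []      = ⊤
  Envᴶ (σ ∷ Γ) = ⟦ σ ᴶ ⟧ × Envᴶ Γ

  lookupᴶ : ∀ {Γ σ} → Envᴶ Γ → Γ ∋ σ → ⟦ σ ᴶ ⟧
  lookupᴶ (a , ρ) here      = a
  lookupᴶ (a , ρ) (there x) = lookupᴶ ρ x

  jeval : ∀ {Γ σ} → Tm Γ σ → Envᴶ Γ → ⟦ σ ᴶ ⟧
  jeval (var x)   ρ = lookupᴶ ρ x
  jeval (lam t)   ρ = λ a → jeval t (a , ρ)
  jeval (app t u) ρ = jeval t ρ (jeval u ρ)
  jeval zer       ρ = η zero
  jeval succ      ρ = κ (λ n → η (suc n))
  jeval (rec σ)   ρ = λ x f → ke σ (recℕ x (λ n → f (η n)))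
  jeval pair      ρ = _,_
  jeval pr₁       ρ = proj₁
  jeval pr₂       ρ = proj₂

Baire : Set
Baire = ℕ → ℕ

JNty : Ty
JNty = ((ι ⇒ ι) ⇒ ι) ⊗ ((ι ⇒ ι) ⇒ ι)

V : ⟦ JNty ⟧ → Baire → ℕ
V = proj₁

M : ⟦ JNty ⟧ → Baire → ℕ
M = proj₂

ηJ : ℕ → ⟦ JNty ⟧
ηJ n = (λ α → n) , (λ α → 0)

κJ : (ℕ → ⟦ JNty ⟧) → ⟦ JNty ⟧ → ⟦ JNty ⟧
κJ g w = (λ α → V (g (V w α)) α) , (λ α → M (g (V w α)) α ⊔ M w α)

Ω : ⟦ JNty ⟧ → ⟦ JNty ⟧
Ω = κJ (λ n → (λ α → α n) , (λ α → suc n))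

open JTranslation JNty ηJ κJ public

module Submission where

-- A term is related to its J-translation by a logical relation indexed by the
-- Baire point α: at base type, w : JN tracks a continuous family x : Baire → ℕ
-- when V_w computes x and M_w is a modulus of continuity for x.  κ preserves
-- tracking because the modulus it builds is the maximum of the two moduli
-- involved, and Ω tracks the identity family since α n only depends on the
-- first n + 1 values of α.  The relation is lifted to all types in the usual
-- way; the fundamental lemma follows by induction on terms, the case of rec
-- reducing to κ through ke by induction on the type.

open import Defs
open import Data.Nat using (ℕ; zero; suc; _<_; _≤_; _⊔_)
open import Data.Nat.Properties using (<-≤-trans; m≤m⊔n; m≤n⊔m; ≤-refl)
open import Data.List using ([]; _∷_)
open import Data.Unit using (⊤; tt)
open import Data.Product using (_×_; _,_; proj₁; proj₂)
open import Relation.Binary.PropositionalEquality using (_≡_; refl; trans; cong; subst)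

_≡[_]_ : Baire → ℕ → Baire → Set
α ≡[ m ] β = ∀ i → i < m → α i ≡ β i

≡[]-mono : ∀ {m n α β} → m ≤ n → α ≡[ n ] β → α ≡[ m ] β
≡[]-mono m≤n α≡β i i<m = α≡β i (<-≤-trans i<m m≤n)

record Tracks (x : Baire → ℕ) (w : ⟦ JNty ⟧) : Set where
  field
    value   : ∀ α → V w α ≡ x α
    modulus : ∀ α β → α ≡[ M w α ] β → x α ≡ x β
open Tracks

η-tracks : ∀ n → Tracks (λ _ → n) (ηJ n)
η-tracks n = record { value = λ _ → refl ; modulus = λ _ _ _ → refl }

κ-tracks : ∀ (h : Baire → ℕ → ℕ) g x w →
           (∀ n → Tracks (λ α → h α n) (g n)) → Tracks x w →
           Tracks (λ α → h α (x α)) (κJ g w)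
κ-tracks h g x w g-tracks w-tracks = record { value = value′ ; modulus = modulus′ }
  where
  value′ : ∀ α → V (g (V w α)) α ≡ h α (x α)
  value′ α rewrite value w-tracks α = value (g-tracks (x α)) α

  modulus′ : ∀ α β → α ≡[ M (g (V w α)) α ⊔ M w α ] β → h α (x α) ≡ h β (x β)
  modulus′ α β α≡β = trans (modulus (g-tracks (x α)) α β α≡β-outer)
                           (cong (h β) (modulus w-tracks α β (≡[]-mono (m≤n⊔m _ _) α≡β)))
    where
    α≡β-outer : α ≡[ M (g (x α)) α ] β
    α≡β-outer = subst (λ k → α ≡[ M (g k) α ] β) (value w-tracks α)
                      (≡[]-mono (m≤m⊔n _ _) α≡β)

Related : ∀ σ → (Baire → ⟦ σ ⟧) → ⟦ σ ᴶ ⟧ → Set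
Related ι       x w = Tracks x w
Related (σ ⇒ τ) x y = ∀ a b → Related σ a b → Related τ (λ α → x α (a α)) (y b)
Related (σ ⊗ τ) x y = Related σ (λ α → proj₁ (x α)) (proj₁ y)
                    × Related τ (λ α → proj₂ (x α)) (proj₂ y)

Ω-related : Related (ι ⇒ ι) (λ α → α) Ω
Ω-related x w = κ-tracks (λ α n → α n) _ x w
  (λ n → record { value = λ _ → refl ; modulus = λ α β α≡β → α≡β n ≤-refl })

ke-related : ∀ σ (h : Baire → ℕ → ⟦ σ ⟧) g x w →
             (∀ n → Related σ (λ α → h α n) (g n)) → Tracks x w →
             Related σ (λ α → h α (x α)) (ke σ g w)
ke-related ι       h g x w hg xw = κ-tracks h g x w hg xw
ke-related (σ ⇒ τ) h g x w hg xw = λ a b ab →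
  ke-related τ (λ α n → h α n (a α)) (λ n → g n b) x w (λ n → hg n a b ab) xw
ke-related (σ ⊗ τ) h g x w hg xw =
  ke-related σ (λ α n → proj₁ (h α n)) (λ n → proj₁ (g n)) x w (λ n → proj₁ (hg n)) xw ,
  ke-related τ (λ α n → proj₂ (h α n)) (λ n → proj₂ (g n)) x w (λ n → proj₂ (hg n)) xw

recℕ-related : ∀ σ (a : Baire → ⟦ σ ⟧) x F f →
               Related σ a x → Related (ι ⇒ σ ⇒ σ) F f →
               ∀ n → Related σ (λ α → recℕ (a α) (F α) n) (recℕ x (λ m → f (ηJ m)) n)
recℕ-related σ a x F f ax Ff zero    = ax
recℕ-related σ a x F f ax Ff (suc n) =
  Ff (λ _ → n) (ηJ n) (η-tracks n) _ _ (recℕ-related σ a x F f ax Ff n)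

RelatedEnv : ∀ Γ → (Baire → Env Γ) → Envᴶ Γ → Set
RelatedEnv []      ρ ρᴶ = ⊤
RelatedEnv (σ ∷ Γ) ρ ρᴶ = Related σ (λ α → proj₁ (ρ α)) (proj₁ ρᴶ)
                        × RelatedEnv Γ (λ α → proj₂ (ρ α)) (proj₂ ρᴶ)

lookup-related : ∀ {Γ σ} (x : Γ ∋ σ) ρ ρᴶ → RelatedEnv Γ ρ ρᴶ →
                 Related σ (λ α → lookup (ρ α) x) (lookupᴶ ρᴶ x)
lookup-related here      ρ ρᴶ (r , _)  = r
lookup-related (there x) ρ ρᴶ (_ , rs) = lookup-related x (λ α → proj₂ (ρ α)) (proj₂ ρᴶ) rs

eval-related : ∀ {Γ σ} (t : Tm Γ σ) ρ ρᴶ → RelatedEnv Γ ρ ρᴶ →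
               Related σ (λ α → eval t (ρ α)) (jeval t ρᴶ)
eval-related (var x)   ρ ρᴶ r = lookup-related x ρ ρᴶ r
eval-related (lam t)   ρ ρᴶ r = λ a b ab → eval-related t (λ α → a α , ρ α) (b , ρᴶ) (ab , r)
eval-related (app t u) ρ ρᴶ r = eval-related t ρ ρᴶ r _ _ (eval-related u ρ ρᴶ r)
eval-related zer       ρ ρᴶ r = η-tracks zero
eval-related succ      ρ ρᴶ r = λ x w xw →
  κ-tracks (λ _ n → suc n) (λ n → ηJ (suc n)) x w (λ n → η-tracks (suc n)) xw
eval-related (rec σ)   ρ ρᴶ r = λ a x ax F f Ff n w nw →
  ke-related σ (λ α m → recℕ (a α) (F α) m) (recℕ x (λ m → f (ηJ m))) n w
             (recℕ-related σ a x F f ax Ff) nw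
eval-related pair      ρ ρᴶ r = λ _ _ ab _ _ cd → ab , cd
eval-related pr₁       ρ ρᴶ r = λ _ _ ab → proj₁ ab
eval-related pr₂       ρ ρᴶ r = λ _ _ ab → proj₂ ab

theorem7 : (f : Closed ((ι ⇒ ι) ⇒ ι)) (α β : ℕ → ℕ) →
    (∀ i → i < M (jeval f tt Ω) α → α i ≡ β i) →
    eval f tt α ≡ eval f tt β
theorem7 f α β = modulus f-tracks α β
  where
  f-tracks : Tracks (λ α → eval f tt α) (jeval f tt Ω)
  f-tracks = eval-related f (λ _ → tt) tt tt (λ α → α) Ω Ω-related
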